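{- Let $\Sigma=\{0,1\}$, $S=\{x\in\{0,1\}^{\omega^2}: \exists m\ \exists^\infty n\ x(m,n)=1\}$, and let $h$ and $R$ be as in the context. Then for every $x\in\Sigma^{\omega^2}$: $h(x)\in R$ if and only if $x\in S$; that is, $S=h^{ -1}(R)$.
   Context: $\Sigma^{\omega^2}$ is the set of families $x=(x(m,n))_{m,n\ge1}$ of letters of $\Sigma$. $A$ is a letter not in $\Sigma$. For $p\ge2$ let $B_p(x)=x(p,1)x(p-1,2)\cdots x(1,p)$ and $B'_p(x)=x(1,p)x(2,p-1)\cdots x(p,1)$; $\sigma_1=x(1,1)\,A\,B_2(x)\,A\,B_4(x)\,A\cdots$ (even $p\ge2$, increasing, each block followed by $A$), $\sigma_2=A\,B'_3(x)\,A\,B'_5(x)\,A\cdots$ (odd $p\ge3$, increasing, each block followed by $A$), and $h(x)=(\sigma_1,\sigma_2)$. $R$ is the set of pairs $(y_1,y_2)$ of $\omega$-words over $\Sigma\cup\{A\}$ for which there exist an integer $k\ge1$, words $U_k,V_k\in(\Sigma^\star A)^k$, a word $u$ which is empty or a single letter of $\Sigma$, and for all $i\ge1$ letters $t(i)\in\Sigma$ and words $u_i,v_i,g_i,z_i\in\Sigma^\star$ with $|v_i|=|u_i|$ and $|g_i|=|z_i|+1$, such that $y_1=U_k\,u\,t(1)\,v_1\,A\,g_1\,t(3)\,v_2\,A\,g_2\,t(5)\,v_3\,A\cdots g_n\,t(2n+1)\,v_{n+1}\,A\cdots$, $y_2=V_k\,u_1\,t(2)\,z_1\,A\,u_2\,t(4)\,z_2\,A\cdots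 u_n\,t(2n)\,z_n\,A\cdots$, and the $\omega$-word $t(1)t(2)t(3)\cdots$ contains infinitely many occurrences of the letter $1$. -}

module Defs where

open import Data.Nat using (ℕ; zero; suc; _+_; _*_; _∸_; _≤_)
open import Data.List using (List; []; _∷_; _++_; map; length; concat; upTo)
open import Data.Vec using (Vec; toList)
open import Data.Maybe using (Maybe)
import Data.Maybe as Maybe
open import Data.Product using (Σ; ∃; _×_; _,_)
open import Relation.Binary.PropositionalEquality using (_≡_)

data Bit : Set where
  𝟘 𝟙 : Bit

data Γ : Set where
  ι : Bit → Γ
  A : Γ

ωWord : Set
ωWord = ℕ → Γ

_≐_ : ωWord → ωWord → Set
y ≐ z = ∀ i → y i ≡ z i

-- Families x = (x(m,n))_{m,n≥1}; we store x(m,n) as  x (m ∸ 1) (n ∸ 1),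
-- i.e. the Agda family is 0-indexed.
Family : Set
Family = ℕ → ℕ → Bit

_++ω_ : List Γ → ωWord → ωWord
([] ++ω r) i = r i
((a ∷ l) ++ω r) zero = a
((a ∷ l) ++ω r) (suc i) = (l ++ω r) i

-- infinite concatenation of finite words (blocks), intended for blocks that
-- are all nonempty (then block j is consumed within fuel j+1).
concatωAux : (ℕ → List Γ) → ℕ → ℕ → ωWord
concatωAux f zero k i = A
concatωAux f (suc fuel) k i = (f k ++ω concatωAux f fuel (suc k)) i

concatω : (ℕ → List Γ) → ωWord
concatω f i = concatωAux f (suc i) 0 i

emb : List Bit → List Γ
emb = map ι

B : Family → ℕ → List Γ
B x p = map (λ r → ι (x (p ∸ 1 ∸ r) r)) (upTo p)

B′ : Family → ℕ → List Γ
B′ x p = map (λ r → ι (x r (p ∸ 1 ∸ r))) (upTo p)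

σ₁ : Family → ωWord
σ₁ x = concatω blk
  where
  blk : ℕ → List Γ
  blk zero = ι (x 0 0) ∷ A ∷ []
  blk (suc j) = B x (2 * suc j) ++ (A ∷ [])

σ₂ : Family → ωWord
σ₂ x = (A ∷ []) ++ω concatω (λ j → B′ x (2 * j + 3) ++ (A ∷ []))

h : Family → ωWord × ωWord
h x = σ₁ x , σ₂ x

ΣstarA : ∀ {k} → Vec (List Bit) k → List Γ
ΣstarA ws = concat (map (λ w → emb w ++ (A ∷ [])) (toList ws))

InfMany𝟙 : (ℕ → Bit) → Set
InfMany𝟙 t = ∀ N → ∃ λ j → N ≤ j × t j ≡ 𝟙

-- The relation R.  Index shift: t j = t(j+1), u j = u_{j+1}, etc.
-- Block n ≥ 1 of y1 is  t(2n-1) v_n A g_n ,  block n of y2 is  u_n t(2n) z_n A.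
InR : ωWord × ωWord → Set
InR (y₁ , y₂) =
  Σ ℕ λ k → 1 ≤ k ×
  Σ (Vec (List Bit) k) λ U → Σ (Vec (List Bit) k) λ V →
  Σ (Maybe Bit) λ u →
  Σ (ℕ → Bit) λ t →
  Σ (ℕ → List Bit) λ uu → Σ (ℕ → List Bit) λ v →
  Σ (ℕ → List Bit) λ g → Σ (ℕ → List Bit) λ z →
    (∀ j → length (v j) ≡ length (uu j)) ×
    (∀ j → length (g j) ≡ suc (length (z j))) ×
    (y₁ ≐ ((ΣstarA U ++ emb (Maybe.maybe (λ b → b ∷ []) [] u)) ++ω
            concatω (λ j → ι (t (2 * j)) ∷ emb (v j) ++ A ∷ emb (g j)))) ×
    (y₂ ≐ (ΣstarA V ++ω
            concatω (λ j → emb (uu j) ++ ι (t (2 * j + 1)) ∷ emb (z j) ++ A ∷ []))) ×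
    InfMany𝟙 t

InS : Family → Set
InS x = ∃ λ m → ∀ N → ∃ λ n → N ≤ n × x m n ≡ 𝟙

module Submission where

-- Both components of h(x) are A-separated words  w₀ A w₁ A w₂ A …  with
-- wⱼ ∈ Σ*: the blocks of σ₁ are x(1,1) and the even anti-diagonals B_{2j},
-- those of σ₂ are ε and the odd anti-diagonals B'_{2j+1}.  Such a
-- factorisation is unique, so a witness of h(x) ∈ R is the same thing as a
-- `Decomposition` of the anti-diagonals beyond the k-th: the j-th even one
-- splits as  g t(2j) v  and the j-th odd one as  u t(2j+1) z,  subject to the
-- length constraints of R.  Counting lengths along consecutive diagonals
-- shows that |v| is a constant m and that every letter t(n) is the entry of
-- row m at column a + n, where a ∈ {0,1} is the length of the optional letter
-- of R.  Conversely every row m carries such a decomposition (choose a with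
-- a + m + 1 even).
--
-- Indexing: the Agda family is 0-indexed, so  x m n  stands for x(m+1,n+1).

open import Defs
open import Function.Bundles using (_⇔_; mk⇔)
open import Function using (_∘_)
open import Data.Nat using (ℕ; zero; suc; _+_; _*_; _∸_; _≤_; _<_; z≤n; s≤s)
open import Data.Nat.Properties
open import Data.Nat.Tactic.RingSolver using (solve-∀)
open import Data.List using (List; []; _∷_; _++_; length; applyUpTo)
open import Data.List.Properties
  using (map-++; ++-assoc; length-applyUpTo; map-applyUpTo; map-upTo; ∷-injectiveʳ)
open import Data.Vec using (Vec) renaming ([] to []ᵥ; _∷_ to _∷ᵥ_)
open import Data.Maybe using (Maybe; just; nothing; maybe)
open import Data.Product using (Σ; _×_; _,_; proj₁; proj₂)
open import Data.Sum using (_⊎_; inj₁; inj₂)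
open import Relation.Binary.PropositionalEquality
open import Relation.Binary.Bundles using (Setoid)
import Relation.Binary.Reasoning.Setoid as SetoidReasoning

≐-refl : ∀ {y} → y ≐ y
≐-refl i = refl

≐-sym : ∀ {y z} → y ≐ z → z ≐ y
≐-sym p i = sym (p i)

≐-trans : ∀ {y z w} → y ≐ z → z ≐ w → y ≐ w
≐-trans p q i = trans (p i) (q i)

≐-setoid : Setoid _ _
≐-setoid = record
  { Carrier = ωWord ; _≈_ = _≐_
  ; isEquivalence = record { refl = ≐-refl ; sym = ≐-sym ; trans = ≐-trans } }

module ≐-Reasoning = SetoidReasoning ≐-setoid

++ω-local : ∀ (L : List Γ) r r' i → (∀ i' → length L + i' ≡ i → r i' ≡ r' i') →
            (L ++ω r) i ≡ (L ++ω r') i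
++ω-local [] r r' i same = same i refl
++ω-local (a ∷ L) r r' zero same = refl
++ω-local (a ∷ L) r r' (suc i) same = ++ω-local L r r' i (λ i' e → same i' (cong suc e))

++ω-congʳ : ∀ (L : List Γ) {r r'} → r ≐ r' → (L ++ω r) ≐ (L ++ω r')
++ω-congʳ L q i = ++ω-local L _ _ i (λ i' _ → q i')

++ω-cong : ∀ {L L' : List Γ} {r r'} → L ≡ L' → r ≐ r' → (L ++ω r) ≐ (L' ++ω r')
++ω-cong {L} refl = ++ω-congʳ L

++ω-assoc : ∀ (L L' : List Γ) r → ((L ++ L') ++ω r) ≐ (L ++ω (L' ++ω r))
++ω-assoc [] L' r i = refl
++ω-assoc (a ∷ L) L' r zero = refl
++ω-assoc (a ∷ L) L' r (suc i) = ++ω-assoc L L' r i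

-- Infinite concatenation is only meaningful for families of nonempty blocks.
Nonempty : (ℕ → List Γ) → Set
Nonempty f = ∀ k → 1 ≤ length (f k)

concatωAux-fuel : ∀ f → Nonempty f → ∀ fuel fuel' k i → i < fuel → i < fuel' →
                  concatωAux f fuel k i ≡ concatωAux f fuel' k i
concatωAux-fuel f ne (suc fuel) (suc fuel') k i (s≤s i≤fuel) (s≤s i≤fuel') =
  ++ω-local (f k) _ _ i (λ i' e →
    concatωAux-fuel f ne fuel fuel' (suc k) i' (before e i≤fuel) (before e i≤fuel'))
  where
  before : ∀ {i' F} → length (f k) + i' ≡ i → i ≤ F → i' < F
  before {i'} e i≤F = ≤-trans (≤-trans (+-monoˡ-≤ i' (ne k)) (≤-reflexive e)) i≤F

concatωAux-shift : ∀ f fuel k → concatωAux f fuel (suc k) ≐ concatωAux (f ∘ suc) fuel k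
concatωAux-shift f zero k i = refl
concatωAux-shift f (suc fuel) k i =
  ++ω-local (f (suc k)) _ _ i (λ i' _ → concatωAux-shift f fuel (suc k) i')

concatωAux-cong : ∀ f f' → (∀ j → f j ≡ f' j) → ∀ fuel k →
                  concatωAux f fuel k ≐ concatωAux f' fuel k
concatωAux-cong f f' same zero k i = refl
concatωAux-cong f f' same (suc fuel) k = ++ω-cong (same k) (concatωAux-cong f f' same fuel (suc k))

concatω-cong : ∀ f f' → (∀ j → f j ≡ f' j) → concatω f ≐ concatω f'
concatω-cong f f' same i = concatωAux-cong f f' same (suc i) 0 i

concatω-unfold : ∀ f → Nonempty f → concatω f ≐ (f 0 ++ω concatω (f ∘ suc))
concatω-unfold f ne i = ++ω-local (f 0) _ _ i (λ i' e →
  trans (concatωAux-shift f i 0 i')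
        (concatωAux-fuel (f ∘ suc) (ne ∘ suc) i (suc i') 0 i' (before e) ≤-refl))
  where
  before : ∀ {i'} → length (f 0) + i' ≡ i → i' < i
  before {i'} e = ≤-trans (+-monoˡ-≤ i' (ne 0)) (≤-reflexive e)

concatω-unfoldAt : ∀ f → Nonempty f → ∀ n →
                   concatω (λ j → f (n + j)) ≐ (f n ++ω concatω (λ j → f (suc n + j)))
concatω-unfoldAt f ne n =
  ≐-trans (concatω-unfold (λ j → f (n + j)) (λ j → ne (n + j)))
          (++ω-cong (cong f (+-identityʳ n)) (concatω-cong _ _ (λ j → cong f (+-suc n j))))

-- A guarded system  Y n = P n · Y (n+1)  (P n nonempty) has at most one
-- solution; this is how two descriptions of the same ω-word are compared.
guarded-unique : (Y Z : ℕ → ωWord) (P : ℕ → List Γ) → Nonempty P →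
                 (∀ n → Y n ≐ (P n ++ω Y (suc n))) → (∀ n → Z n ≐ (P n ++ω Z (suc n))) →
                 ∀ n → Y n ≐ Z n
guarded-unique Y Z P ne eqY eqZ n i = agree (suc i) n i ≤-refl
  where
  agree : ∀ fuel n i → i < fuel → Y n i ≡ Z n i
  agree (suc fuel) n i (s≤s i≤fuel) =
    trans (eqY n i) (trans (++ω-local (P n) _ _ i (λ i' e →
      agree fuel (suc n) i' (≤-trans (+-monoˡ-≤ i' (ne n)) (≤-trans (≤-reflexive e) i≤fuel))))
      (sym (eqZ n i)))

piece : (ℕ → List Bit) → ℕ → List Γ
piece W j = emb (W j) ++ A ∷ []

separated : (ℕ → List Bit) → ωWord
separated W = concatω (piece W)

piece-nonempty : ∀ W → Nonempty (piece W)
piece-nonempty W j with W j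
... | [] = s≤s z≤n
... | _ ∷ _ = s≤s z≤n

separated-unfold : ∀ W → separated W ≐ (piece W 0 ++ω separated (W ∘ suc))
separated-unfold W = concatω-unfold (piece W) (piece-nonempty W)

ι-injective : ∀ {a b} → ι a ≡ ι b → a ≡ b
ι-injective refl = refl

piece-cancel : ∀ (w w' : List Bit) s r →
               ((emb w ++ A ∷ []) ++ω s) ≐ ((emb w' ++ A ∷ []) ++ω r) → w ≡ w' × s ≐ r
piece-cancel [] [] s r same = refl , (λ i → same (suc i))
piece-cancel [] (b ∷ w') s r same with same 0
... | ()
piece-cancel (a ∷ w) [] s r same with same 0
... | ()
piece-cancel (a ∷ w) (b ∷ w') s r same with piece-cancel w w' s r (λ i → same (suc i))
... | w≡w' , s≐r = cong₂ _∷_ (ι-injective (same 0)) w≡w' , s≐r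

separated-injective : ∀ W W' → separated W ≐ separated W' → ∀ j → W j ≡ W' j
separated-injective W W' same j
  with piece-cancel (W 0) (W' 0) _ _
         (≐-trans (≐-sym (separated-unfold W)) (≐-trans same (separated-unfold W')))
separated-injective W W' same zero | w≡w' , _ = w≡w'
separated-injective W W' same (suc j) | _ , rest =
  separated-injective (W ∘ suc) (W' ∘ suc) rest j

drop-blocks : ∀ {k} (U : Vec (List Bit) k) W r → separated W ≐ (ΣstarA U ++ω r) →
              separated (λ j → W (k + j)) ≐ r
drop-blocks []ᵥ W r same = same
drop-blocks (w ∷ᵥ U) W r same =
  drop-blocks U (W ∘ suc) r (proj₂ (piece-cancel (W 0) w _ _
    (≐-trans (≐-sym (separated-unfold W)) (≐-trans same (++ω-assoc (emb w ++ A ∷ []) _ r)))))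

separated-suffix : ∀ {k} (U : Vec (List Bit) k) W W' →
                   separated W ≐ (ΣstarA U ++ω separated W') → ∀ j → W (k + j) ≡ W' j
separated-suffix U W W' same = separated-injective _ W' (drop-blocks U W _ same)

take-blocks : (k : ℕ) → (ℕ → List Bit) → Vec (List Bit) k
take-blocks zero W = []ᵥ
take-blocks (suc k) W = W 0 ∷ᵥ take-blocks k (W ∘ suc)

separated-take : ∀ k W →
                 separated W ≐ (ΣstarA (take-blocks k W) ++ω separated (λ j → W (k + j)))
separated-take zero W = ≐-refl
separated-take (suc k) W =
  ≐-trans (separated-unfold W)
    (≐-trans (++ω-congʳ (piece W 0) (separated-take k (W ∘ suc)))
             (≐-sym (++ω-assoc (piece W 0) (ΣstarA (take-blocks k (W ∘ suc))) _)))

-- The first component of an R-witness after its prefix,  u t(1) v₁ A g₁ t(3) v₂ A …,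
-- regrouped into A-separated blocks  u t(1) v₁ | g₁ t(3) v₂ | g₂ t(5) v₃ | …
y₁-piece : (ℕ → Bit) → (ℕ → List Bit) → (ℕ → List Bit) → ℕ → List Γ
y₁-piece t v g j = ι (t (2 * j)) ∷ emb (v j) ++ A ∷ emb (g j)

evenBlocks : List Bit → (ℕ → Bit) → (ℕ → List Bit) → (ℕ → List Bit) → ℕ → List Bit
evenBlocks u t v g zero = u ++ t 0 ∷ v 0
evenBlocks u t v g (suc j) = g j ++ t (2 * suc j) ∷ v (suc j)

regroup-piece : ∀ pre b v g C →
                (emb pre ++ω ((ι b ∷ emb v ++ A ∷ emb g) ++ω C)) ≐
                ((emb (pre ++ b ∷ v) ++ A ∷ []) ++ω (emb g ++ω C))
regroup-piece pre b v g C =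
  ≐-trans (≐-sym (++ω-assoc (emb pre) _ C))
    (≐-trans (++ω-cong {r = C} lists ≐-refl) (++ω-assoc (emb (pre ++ b ∷ v) ++ A ∷ []) (emb g) C))
  where
  open ≡-Reasoning
  lists : emb pre ++ (ι b ∷ emb v ++ A ∷ emb g) ≡ (emb (pre ++ b ∷ v) ++ A ∷ []) ++ emb g
  lists = begin
      emb pre ++ (ι b ∷ emb v ++ A ∷ emb g)
    ≡⟨ cong (λ w → emb pre ++ (ι b ∷ w)) (sym (++-assoc (emb v) (A ∷ []) (emb g))) ⟩
      emb pre ++ ((ι b ∷ emb v ++ A ∷ []) ++ emb g)
    ≡⟨ sym (++-assoc (emb pre) _ (emb g)) ⟩
      (emb pre ++ (emb (b ∷ v) ++ A ∷ [])) ++ emb g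
    ≡⟨ cong (_++ emb g) (sym (++-assoc (emb pre) (emb (b ∷ v)) (A ∷ []))) ⟩
      ((emb pre ++ emb (b ∷ v)) ++ A ∷ []) ++ emb g
    ≡⟨ cong (λ w → (w ++ A ∷ []) ++ emb g) (sym (map-++ ι pre (b ∷ v))) ⟩
      (emb (pre ++ b ∷ v) ++ A ∷ []) ++ emb g ∎

-- Both sides solve the guarded system whose n-th block is  evenBlocks n.
y₁-separated : ∀ u t v g → (emb u ++ω concatω (y₁-piece t v g)) ≐ separated (evenBlocks u t v g)
y₁-separated u t v g = guarded-unique Y Z (piece W) (piece-nonempty W) eqY eqZ 0
  where
  W = evenBlocks u t v g
  P = y₁-piece t v g
  P-nonempty : Nonempty P
  P-nonempty j = s≤s z≤n
  Y : ℕ → ωWord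
  Y zero = emb u ++ω concatω P
  Y (suc n) = emb (g n) ++ω concatω (λ j → P (suc n + j))
  Z : ℕ → ωWord
  Z n = concatω (λ j → piece W (n + j))
  eqY : ∀ n → Y n ≐ (piece W n ++ω Y (suc n))
  eqY zero = ≐-trans (++ω-congʳ (emb u) (concatω-unfold P P-nonempty))
                     (regroup-piece u (t 0) (v 0) (g 0) _)
  eqY (suc n) = ≐-trans (++ω-congʳ (emb (g n)) (concatω-unfoldAt P P-nonempty (suc n)))
                        (regroup-piece (g n) (t (2 * suc n)) (v (suc n)) (g (suc n)) _)
  eqZ : ∀ n → Z n ≐ (piece W n ++ω Z (suc n))
  eqZ = concatω-unfoldAt (piece W) (piece-nonempty W)

oddBlocks : (ℕ → Bit) → (ℕ → List Bit) → (ℕ → List Bit) → ℕ → List Bit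
oddBlocks t uu z j = uu j ++ t (2 * j + 1) ∷ z j

y₂-separated : ∀ t uu z →
               concatω (λ j → emb (uu j) ++ ι (t (2 * j + 1)) ∷ emb (z j) ++ A ∷ []) ≐
               separated (oddBlocks t uu z)
y₂-separated t uu z = concatω-cong _ _ (λ j → sym (begin
    emb (uu j ++ t (2 * j + 1) ∷ z j) ++ A ∷ []
  ≡⟨ cong (_++ A ∷ []) (map-++ ι (uu j) (t (2 * j + 1) ∷ z j)) ⟩
    (emb (uu j) ++ ι (t (2 * j + 1)) ∷ emb (z j)) ++ A ∷ []
  ≡⟨ ++-assoc (emb (uu j)) _ (A ∷ []) ⟩
    emb (uu j) ++ ι (t (2 * j + 1)) ∷ emb (z j) ++ A ∷ [] ∎))
  where open ≡-Reasoning

applyUpTo-split : ∀ (F : ℕ → Bit) n pre b post → applyUpTo F n ≡ pre ++ b ∷ post →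
                  b ≡ F (length pre) × length pre + suc (length post) ≡ n
applyUpTo-split F zero [] b post ()
applyUpTo-split F zero (_ ∷ _) b post ()
applyUpTo-split F (suc n) [] b post refl = refl , cong suc (length-applyUpTo (F ∘ suc) n)
applyUpTo-split F (suc n) (_ ∷ pre) b post e
  with applyUpTo-split (F ∘ suc) n pre b post (∷-injectiveʳ e)
... | b≡F , lengths = b≡F , cong suc lengths

applyUpTo-at : ∀ (F : ℕ → Bit) n a b m → n ≡ a + suc m → F a ≡ b →
               applyUpTo F n ≡ applyUpTo F a ++ b ∷ applyUpTo (λ r → F (a + suc r)) m
applyUpTo-at F n zero b m refl refl = refl
applyUpTo-at F n (suc a) b m refl Fa≡b =
  cong (F 0 ∷_) (applyUpTo-at (F ∘ suc) (a + suc m) a b m refl Fa≡b)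

evenDiag oddDiag : Family → ℕ → ℕ → Bit
evenDiag x p r = x (p ∸ 1 ∸ r) r
oddDiag x p r = x r (p ∸ 1 ∸ r)

diagonal-offset : ∀ a b p → a + suc b ≡ p → p ∸ 1 ∸ a ≡ b
diagonal-offset a b p refl rewrite +-suc a b = m+n∸m≡n a b

σ₁Blocks σ₂Blocks : Family → ℕ → List Bit
σ₁Blocks x zero = x 0 0 ∷ []
σ₁Blocks x (suc j) = applyUpTo (evenDiag x (2 * suc j)) (2 * suc j)
σ₂Blocks x zero = []
σ₂Blocks x (suc j) = applyUpTo (oddDiag x (2 * j + 3)) (2 * j + 3)

σ₁-separated : ∀ x → σ₁ x ≐ separated (σ₁Blocks x)
σ₁-separated x i =
  ++ω-congʳ (ι (x 0 0) ∷ A ∷ []) (concatωAux-cong _ (piece (σ₁Blocks x)) (λ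
  { zero → refl
  ; (suc j) → cong (_++ A ∷ [])
      (trans (map-upTo _ (2 * suc j)) (sym (map-applyUpTo (evenDiag x (2 * suc j)) ι (2 * suc j)))) }) i 1) i

σ₂-separated : ∀ x → σ₂ x ≐ separated (σ₂Blocks x)
σ₂-separated x = ≐-sym (≐-trans (separated-unfold (σ₂Blocks x))
  (++ω-congʳ (A ∷ []) (concatω-cong _ _ λ j → cong (_++ A ∷ [])
    (trans (map-applyUpTo (oddDiag x (2 * j + 3)) ι (2 * j + 3))
           (sym (map-upTo _ (2 * j + 3)))))))

optional : Maybe Bit → List Bit
optional u = maybe (λ b → b ∷ []) [] u

-- An R-witness for h(x) read through the block structure of σ₁ and σ₂
-- (0-indexed, t n = t(n+1)): beyond the first k+1 blocks the even diagonals
-- are  u t 0 v₀,  g₀ t 2 v₁,  g₁ t 4 v₂, …  and the odd ones  uⱼ t(2j+1) zⱼ.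
record Decomposition (x : Family) : Set where
  field
    k : ℕ
    u : Maybe Bit
    t : ℕ → Bit
    uu v g z : ℕ → List Bit
    |v|≡|uu| : ∀ j → length (v j) ≡ length (uu j)
    |g|≡1+|z| : ∀ j → length (g j) ≡ suc (length (z j))
    even-diagonals : ∀ j → σ₁Blocks x (suc k + j) ≡ evenBlocks (optional u) t v g j
    odd-diagonals : ∀ j → σ₂Blocks x (suc k + j) ≡ oddBlocks t uu z j
    infinitely-many-𝟙 : InfMany𝟙 t

-- Since A-separated factorisations are unique, an R-witness yields a decomposition ...
decompose : ∀ x → InR (h x) → Decomposition x
decompose x (zero , () , _)
decompose x (suc k , _ , U , V , u , t , uu , v , g , z , |v|≡|uu| , |g|≡1+|z| , y₁≐ , y₂≐ , inf) =
  record
    { k = k ; u = u ; t = t ; uu = uu ; v = v ; g = g ; z = z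
    ; |v|≡|uu| = |v|≡|uu| ; |g|≡1+|z| = |g|≡1+|z|
    ; even-diagonals = separated-suffix U (σ₁Blocks x) _ σ₁-form
    ; odd-diagonals = separated-suffix V (σ₂Blocks x) _ σ₂-form
    ; infinitely-many-𝟙 = inf }
  where
  open ≐-Reasoning
  σ₁-form : separated (σ₁Blocks x) ≐ (ΣstarA U ++ω separated (evenBlocks (optional u) t v g))
  σ₁-form = begin
    separated (σ₁Blocks x)                                       ≈⟨ σ₁-separated x ⟨
    σ₁ x                                                         ≈⟨ y₁≐ ⟩
    (ΣstarA U ++ emb (optional u)) ++ω concatω (y₁-piece t v g)  ≈⟨ ++ω-assoc (ΣstarA U) (emb (optional u)) _ ⟩
    ΣstarA U ++ω (emb (optional u) ++ω concatω (y₁-piece t v g)) ≈⟨ ++ω-congʳ (ΣstarA U) (y₁-separated (optional u) t v g) ⟩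
    ΣstarA U ++ω separated (evenBlocks (optional u) t v g)       ∎
  σ₂-form : separated (σ₂Blocks x) ≐ (ΣstarA V ++ω separated (oddBlocks t uu z))
  σ₂-form = begin
    separated (σ₂Blocks x)  ≈⟨ σ₂-separated x ⟨
    σ₂ x                    ≈⟨ ≐-trans y₂≐ (++ω-congʳ (ΣstarA V) (y₂-separated t uu z)) ⟩
    ΣstarA V ++ω separated (oddBlocks t uu z) ∎

-- ... and conversely, taking the first k+1 blocks as the prefixes U and V.
recompose : ∀ {x} → Decomposition x → InR (h x)
recompose {x} D =
  suc k , s≤s z≤n , U , V , u , t , uu , v , g , z , |v|≡|uu| , |g|≡1+|z| , y₁≐ , y₂≐ , infinitely-many-𝟙
  where
  open Decomposition D
  open ≐-Reasoning
  U V : Vec (List Bit) (suc k)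
  U = take-blocks (suc k) (σ₁Blocks x)
  V = take-blocks (suc k) (σ₂Blocks x)
  y₁≐ : σ₁ x ≐ ((ΣstarA U ++ emb (optional u)) ++ω concatω (y₁-piece t v g))
  y₁≐ = begin
    σ₁ x                                                         ≈⟨ σ₁-separated x ⟩
    separated (σ₁Blocks x)                                       ≈⟨ separated-take (suc k) (σ₁Blocks x) ⟩
    ΣstarA U ++ω separated (λ j → σ₁Blocks x (suc k + j))        ≈⟨ ++ω-congʳ (ΣstarA U)
                                                                      (concatω-cong _ _ (cong (λ w → emb w ++ A ∷ []) ∘ even-diagonals)) ⟩
    ΣstarA U ++ω separated (evenBlocks (optional u) t v g)       ≈⟨ ++ω-congʳ (ΣstarA U) (y₁-separated (optional u) t v g) ⟨
    ΣstarA U ++ω (emb (optional u) ++ω concatω (y₁-piece t v g)) ≈⟨ ++ω-assoc (ΣstarA U) (emb (optional u)) _ ⟨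
    (ΣstarA U ++ emb (optional u)) ++ω concatω (y₁-piece t v g)  ∎
  y₂≐ : σ₂ x ≐ (ΣstarA V ++ω concatω (λ j → emb (uu j) ++ ι (t (2 * j + 1)) ∷ emb (z j) ++ A ∷ []))
  y₂≐ = begin
    σ₂ x                                                    ≈⟨ σ₂-separated x ⟩
    separated (σ₂Blocks x)                                  ≈⟨ separated-take (suc k) (σ₂Blocks x) ⟩
    ΣstarA V ++ω separated (λ j → σ₂Blocks x (suc k + j))   ≈⟨ ++ω-congʳ (ΣstarA V)
                                                                 (concatω-cong _ _ (cong (λ w → emb w ++ A ∷ []) ∘ odd-diagonals)) ⟩
    ΣstarA V ++ω separated (oddBlocks t uu z)               ≈⟨ ++ω-congʳ (ΣstarA V) (y₂-separated t uu z) ⟨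
    ΣstarA V ++ω concatω (λ j → emb (uu j) ++ ι (t (2 * j + 1)) ∷ emb (z j) ++ A ∷ []) ∎

InfMany𝟙-resp : ∀ {s s' : ℕ → Bit} → (∀ n → s n ≡ s' n) → InfMany𝟙 s → InfMany𝟙 s'
InfMany𝟙-resp s≗s' inf N with inf N
... | n , N≤n , sn≡𝟙 = n , N≤n , trans (sym (s≗s' n)) sn≡𝟙

InfMany𝟙-drop : ∀ (s : ℕ → Bit) a → InfMany𝟙 s → InfMany𝟙 (λ n → s (a + n))
InfMany𝟙-drop s a inf N with inf (N + a)
... | n , N+a≤n , sn≡𝟙 =
  n ∸ a , subst (_≤ n ∸ a) (m+n∸n≡m N a) (∸-monoˡ-≤ a N+a≤n) ,
  trans (cong s (m+[n∸m]≡n (≤-trans (m≤n+m a N) N+a≤n))) sn≡𝟙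

InfMany𝟙-undrop : ∀ (s : ℕ → Bit) a → InfMany𝟙 (λ n → s (a + n)) → InfMany𝟙 s
InfMany𝟙-undrop s a inf N with inf N
... | n , N≤n , sn≡𝟙 = a + n , ≤-trans N≤n (m≤n+m n a) , sn≡𝟙

even-or-odd : ∀ n → Σ ℕ λ j → (n ≡ 2 * j) ⊎ (n ≡ 2 * j + 1)
even-or-odd zero = 0 , inj₁ refl
even-or-odd (suc n) with even-or-odd n
... | j , inj₁ n≡2j = j , inj₂ (trans (cong suc n≡2j) (+-comm 1 (2 * j)))
... | j , inj₂ n≡2j+1 = suc j , inj₁ (trans (cong suc n≡2j+1) (lemma j))
  where
  lemma : ∀ j → suc (2 * j + 1) ≡ 2 * suc j
  lemma = solve-∀

-- Once the first relevant even diagonal (length 2k+2) is split as a + 1 + m,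
-- the even diagonal j further on splits as (a + 2j) + 1 + m and the odd
-- diagonal j as m + 1 + (a + 2j + 1): the marked letters stay in row m.
even-diagonal-split : ∀ k j a m → a + suc m ≡ 2 * suc k →
                      2 * suc (k + suc j) ≡ (a + 2 * suc j) + suc m
even-diagonal-split k j a m split = trans (lemma k j) (trans (cong (_+ 2 * suc j) (sym split)) (lemma' a m j))
  where
  lemma : ∀ k j → 2 * suc (k + suc j) ≡ 2 * suc k + 2 * suc j
  lemma = solve-∀
  lemma' : ∀ a m j → (a + suc m) + 2 * suc j ≡ (a + 2 * suc j) + suc m
  lemma' = solve-∀

odd-diagonal-split : ∀ k j a m → a + suc m ≡ 2 * suc k →
                     2 * (k + j) + 3 ≡ m + suc (a + (2 * j + 1))
odd-diagonal-split k j a m split = trans (lemma k j) (trans (cong (_+ (2 * j + 1)) (sym split)) (lemma' a m j))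
  where
  lemma : ∀ k j → 2 * (k + j) + 3 ≡ 2 * suc k + (2 * j + 1)
  lemma = solve-∀
  lemma' : ∀ a m j → (a + suc m) + (2 * j + 1) ≡ m + suc (a + (2 * j + 1))
  lemma' = solve-∀

column-step : ∀ a j → suc (a + (2 * j + 1)) ≡ a + 2 * suc j
column-step = solve-∀

-- In a decomposition all marked letters lie in row m = |v₀|: t n = x(m, a + n)
-- with a = |u|.  The lengths |vⱼ| = |uⱼ| = m, |zⱼ| = a + 2j + 1 and
-- |gⱼ| = a + 2j + 2 are obtained by induction along the diagonals.
module RowOf {x : Family} (D : Decomposition x) where
  open Decomposition D
  open ≡-Reasoning

  a m : ℕ
  a = length (optional u)
  m = length (v 0)

  first-even : t 0 ≡ evenDiag x (2 * suc (k + 0)) a × a + suc m ≡ 2 * suc (k + 0)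
  first-even = applyUpTo-split (evenDiag x (2 * suc (k + 0))) _ (optional u) (t 0) (v 0) (even-diagonals 0)

  later-even : ∀ j → t (2 * suc j) ≡ evenDiag x (2 * suc (k + suc j)) (length (g j)) ×
                     length (g j) + suc (length (v (suc j))) ≡ 2 * suc (k + suc j)
  later-even j = applyUpTo-split (evenDiag x (2 * suc (k + suc j))) _ (g j) _ (v (suc j)) (even-diagonals (suc j))

  odd : ∀ j → t (2 * j + 1) ≡ oddDiag x (2 * (k + j) + 3) (length (uu j)) ×
              length (uu j) + suc (length (z j)) ≡ 2 * (k + j) + 3
  odd j = applyUpTo-split (oddDiag x (2 * (k + j) + 3)) _ (uu j) _ (z j) (odd-diagonals j)

  first-split : a + suc m ≡ 2 * suc k
  first-split = trans (proj₂ first-even) (cong (λ q → 2 * suc q) (+-identityʳ k))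

  |v|≡m : ∀ j → length (v j) ≡ m
  |uu|≡m : ∀ j → length (uu j) ≡ m
  |z|≡ : ∀ j → length (z j) ≡ a + (2 * j + 1)
  |g|≡ : ∀ j → length (g j) ≡ a + 2 * suc j

  |v|≡m zero = refl
  |v|≡m (suc j) = suc-injective (+-cancelˡ-≡ (a + 2 * suc j) _ _ (begin
      (a + 2 * suc j) + suc (length (v (suc j))) ≡⟨ cong (_+ suc (length (v (suc j)))) (|g|≡ j) ⟨
      length (g j) + suc (length (v (suc j)))     ≡⟨ proj₂ (later-even j) ⟩
      2 * suc (k + suc j)                         ≡⟨ even-diagonal-split k j a m first-split ⟩
      (a + 2 * suc j) + suc m                     ∎))

  |uu|≡m j = trans (sym (|v|≡|uu| j)) (|v|≡m j)

  |z|≡ j = suc-injective (+-cancelˡ-≡ m _ _ (begin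
      m + suc (length (z j))              ≡⟨ cong (_+ suc (length (z j))) (|uu|≡m j) ⟨
      length (uu j) + suc (length (z j))  ≡⟨ proj₂ (odd j) ⟩
      2 * (k + j) + 3                     ≡⟨ odd-diagonal-split k j a m first-split ⟩
      m + suc (a + (2 * j + 1))           ∎))

  |g|≡ j = trans (|g|≡1+|z| j) (trans (cong suc (|z|≡ j)) (column-step a j))

  t-even : ∀ j → t (2 * j) ≡ x m (a + 2 * j)
  t-even zero = trans (proj₁ first-even)
    (cong₂ x (diagonal-offset a m _ (proj₂ first-even)) (sym (+-identityʳ a)))
  t-even (suc j) = trans (proj₁ (later-even j))
    (cong₂ x (trans (diagonal-offset _ _ _ (proj₂ (later-even j))) (|v|≡m (suc j))) (|g|≡ j))

  t-odd : ∀ j → t (2 * j + 1) ≡ x m (a + (2 * j + 1))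
  t-odd j = trans (proj₁ (odd j))
    (cong₂ x (|uu|≡m j) (trans (diagonal-offset _ _ _ (proj₂ (odd j))) (|z|≡ j)))

  t-in-row : ∀ n → t n ≡ x m (a + n)
  t-in-row n with even-or-odd n
  ... | j , inj₁ refl = t-even j
  ... | j , inj₂ refl = t-odd j

decomposition⇒S : ∀ {x} → Decomposition x → InS x
decomposition⇒S {x} D = m , InfMany𝟙-undrop (x m) a (InfMany𝟙-resp t-in-row infinitely-many-𝟙)
  where open Decomposition D
        open RowOf D

-- Conversely, given a row m and a split a + 1 + m of the even diagonal of
-- length 2k+2 (with u the first a ≤ 1 letters of that diagonal), cut every
-- later diagonal at its entry in row m and set t n = x(m, a + n).
module FromRow (x : Family) (m a k : ℕ) (first-split : a + suc m ≡ 2 * suc k)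
               (u : Maybe Bit) (u-prefix : optional u ≡ applyUpTo (evenDiag x (2 * suc (k + 0))) a)
               (row-𝟙 : InfMany𝟙 (x m)) where

  P Q : ℕ → ℕ
  P j = 2 * suc (k + j)
  Q j = 2 * (k + j) + 3

  t : ℕ → Bit
  t n = x m (a + n)

  column : ℕ → ℕ
  column zero = a
  column (suc j) = a + 2 * suc j

  v g uu z : ℕ → List Bit
  v j = applyUpTo (λ r → evenDiag x (P j) (column j + suc r)) m
  g j = applyUpTo (evenDiag x (P (suc j))) (a + 2 * suc j)
  uu j = applyUpTo (oddDiag x (Q j)) m
  z j = applyUpTo (λ r → oddDiag x (Q j) (m + suc r)) (a + (2 * j + 1))

  P₀-split : P 0 ≡ a + suc m
  P₀-split = trans (cong (λ q → 2 * suc q) (+-identityʳ k)) (sym first-split)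

  even-diagonals : ∀ j → σ₁Blocks x (suc k + j) ≡ evenBlocks (optional u) t v g j
  even-diagonals zero =
    trans (applyUpTo-at (evenDiag x (P 0)) (P 0) a (t 0) m P₀-split
             (cong₂ x (diagonal-offset a m (P 0) (sym P₀-split)) (sym (+-identityʳ a))))
          (cong (_++ t 0 ∷ v 0) (sym u-prefix))
  even-diagonals (suc j) =
    applyUpTo-at (evenDiag x (P (suc j))) (P (suc j)) (a + 2 * suc j) (t (2 * suc j)) m split
      (cong (λ r → x r (a + 2 * suc j)) (diagonal-offset _ m _ (sym split)))
    where split = even-diagonal-split k j a m first-split

  odd-diagonals : ∀ j → σ₂Blocks x (suc k + j) ≡ oddBlocks t uu z j
  odd-diagonals j =
    applyUpTo-at (oddDiag x (Q j)) (Q j) m (t (2 * j + 1)) (a + (2 * j + 1)) split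
      (cong (x m) (diagonal-offset m _ (Q j) (sym split)))
    where split = odd-diagonal-split k j a m first-split

  decomposition : Decomposition x
  decomposition = record
    { k = k ; u = u ; t = t ; uu = uu ; v = v ; g = g ; z = z
    ; |v|≡|uu| = λ j → trans (length-applyUpTo _ m) (sym (length-applyUpTo _ m))
    ; |g|≡1+|z| = λ j → trans (length-applyUpTo _ _)
                     (trans (sym (column-step a j)) (cong suc (sym (length-applyUpTo _ _))))
    ; even-diagonals = even-diagonals
    ; odd-diagonals = odd-diagonals
    ; infinitely-many-𝟙 = InfMany𝟙-drop (x m) a row-𝟙 }

-- For an even row m = 2k use a = 1 (u is the first letter of the diagonal of
-- length 2k+2); for an odd row m = 2k+1 use a = 0 (u is empty).
S⇒decomposition : ∀ x → InS x → Decomposition x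
S⇒decomposition x (m , row-𝟙) with even-or-odd m
... | k , inj₁ refl = FromRow.decomposition x (2 * k) 1 k (split k)
                        (just (evenDiag x (2 * suc (k + 0)) 0)) refl row-𝟙
  where
  split : ∀ k → 1 + suc (2 * k) ≡ 2 * suc k
  split = solve-∀
... | k , inj₂ refl = FromRow.decomposition x (2 * k + 1) 0 k (split k) nothing refl row-𝟙
  where
  split : ∀ k → 0 + suc (2 * k + 1) ≡ 2 * suc k
  split = solve-∀

lemma6 : (x : Family) → InR (h x) ⇔ InS x
lemma6 x = mk⇔ (decomposition⇒S ∘ decompose x) (recompose ∘ S⇒decomposition x)
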